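{- For every integer $k > 1$, $\mathrm{NTIME}[\log^k n] \subsetneq \mathrm{NTIME}[\log^{k+1} n]$.
   Context: Throughout, $\log n$ denotes $\log_2 n$ and $\log^k n$ denotes $(\log n)^k$. A random-access Turing machine is a multi-tape Turing machine with (1) a read-only random-access input of length $n+1$ whose first $n$ cells contain the input binary string and whose $(n+1)$-st cell contains an endmark $\triangleleft$, (2) a fixed number of read-write working tapes, and (3) a read-write input address-tape of length $\lceil \log n\rceil$ containing bits; at each step the binary number on the address-tape determines the input cell that is read, and if it exceeds $n$ the endmark cell is read. For a function $f$, $\mathrm{NTIME}[f(n)]$ is the class of languages of binary strings accepted by a non-deterministic random-access Turing machine that makes at most $O(f(n))$ steps before accepting an input of length $n$. -}

module Defs where

open import Level using (0ℓ)
open import Data.Bool using (Bool; true; false; if_then_else_)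
open import Data.Nat using (ℕ; zero; suc; _+_; _*_; _∸_; _^_; _≤_; _<ᵇ_; _≡ᵇ_)
open import Data.Nat.Logarithm using (⌈log₂_⌉)
open import Data.Fin using (Fin; zero)
open import Data.List using (List; []; _∷_; length; map)
open import Data.List.Membership.Propositional using (_∈_)
open import Data.Product using (Σ; _×_; _,_; proj₁; proj₂)
open import Relation.Binary.PropositionalEquality using (_≡_)
open import Relation.Unary using (Pred)

data InSym : Set where
  bit     : Bool → InSym
  endmark : InSym

data Move : Set where
  left stay right : Move

-- A non-deterministic random-access Turing machine.
--   states     : Fin q, start state, accepting states
--   t          : number of read-write working tapes (one-way infinite)
--   Fin (suc g): working-tape alphabet, with  zero  the blank symbol
--   address tape: binary, read-write, of length ⌈log₂ n⌉ (own head)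
--   δ          : finite non-deterministic transition relation; given the
--                state, the input symbol at the current address, the symbols
--                under the t work heads and the bit under the address head,
--                it lists the possible moves: new state, for each work tape
--                (symbol to write, head move), and (bit to write, head move)
--                on the address tape.
record NRTM : Set where
  field
    q g t     : ℕ
    start     : Fin q
    accepting : Fin q → Bool
    δ         : Fin q → InSym → (Fin t → Fin (suc g)) → Bool →
                List (Fin q × (Fin t → Fin (suc g) × Move) × (Bool × Move))

record Config (M : NRTM) : Set where
  constructor config
  open NRTM M
  field
    state : Fin q
    work  : Fin t → ℕ → Fin (suc g)
    wpos  : Fin t → ℕ
    addr  : ℕ → Bool
    apos  : ℕ

readIn : List Bool → ℕ → InSym
readIn []       _       = endmark
readIn (b ∷ bs) zero    = bit b
readIn (b ∷ bs) (suc i) = readIn bs i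

-- Binary number on the first len cells of the address tape
-- (cell 0 is the least significant bit).
addrValue : ℕ → (ℕ → Bool) → ℕ
addrValue zero    a = 0
addrValue (suc l) a = (if a 0 then 1 else 0) + 2 * addrValue l (λ i → a (suc i))

addrLen : ℕ → ℕ
addrLen n = ⌈log₂ n ⌉

update : {A : Set} → (ℕ → A) → ℕ → A → (ℕ → A)
update f p a i = if i ≡ᵇ p then a else f i

-- work tapes: one-way infinite, head stays at cell 0 when moving left there
moveWork : Move → ℕ → ℕ
moveWork left  p = p ∸ 1
moveWork stay  p = p
moveWork right p = suc p

-- address tape: cells 0 .. len-1; the head cannot leave this range
moveAddr : ℕ → Move → ℕ → ℕ
moveAddr len left  p = p ∸ 1
moveAddr len stay  p = p
moveAddr len right p = if suc p <ᵇ len then suc p else p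

readAddr : ℕ → (ℕ → Bool) → ℕ → Bool
readAddr len a p = if p <ᵇ len then a p else false

writeAddr : ℕ → (ℕ → Bool) → ℕ → Bool → (ℕ → Bool)
writeAddr len a p b = if p <ᵇ len then update a p b else a

module _ (M : NRTM) where
  open NRTM M

  initial : Config M
  initial = config start (λ _ _ → zero) (λ _ → 0) (λ _ → false) 0

  next : List Bool → Config M → List (Config M)
  next x (config s w wp a ap) = map apply
    (δ s (readIn x (addrValue len a)) (λ i → w i (wp i)) (readAddr len a ap))
    where
    len = addrLen (length x)
    apply : Fin q × (Fin t → Fin (suc g) × Move) × (Bool × Move) → Config M
    apply (s' , act , (b , m)) =
      config s'
        (λ i → update (w i) (wp i) (proj₁ (act i)))
        (λ i → moveWork (proj₂ (act i)) (wp i))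
        (writeAddr len a ap b)
        (moveAddr len m ap)

  data AccWithin (x : List Bool) : ℕ → Config M → Set where
    here : ∀ {m c} → accepting (Config.state c) ≡ true → AccWithin x m c
    step : ∀ {m c c'} → c' ∈ next x c → AccWithin x m c' → AccWithin x (suc m) c

  AcceptsWithin : List Bool → ℕ → Set
  AcceptsWithin x m = AccWithin x m initial

  Accepts : List Bool → Set
  Accepts x = Σ ℕ λ m → AcceptsWithin x m

NTIME : (ℕ → ℕ) → Pred (List Bool) 0ℓ → Set
NTIME f L =
  Σ NRTM λ M → Σ ℕ λ c → Σ ℕ λ n₀ →
    ((x : List Bool) → (L x → Accepts M x) × (Accepts M x → L x)) ×
    ((x : List Bool) → n₀ ≤ length x → Accepts M x → AcceptsWithin M x (c * f (length x)))

-- log^k n, with log n rounded up to an integer (same up to a constant factor)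
logPow : ℕ → ℕ → ℕ
logPow k n = ⌈log₂ n ⌉ ^ k

-- The inclusion is monotonicity in the time bound. For the separation let d = k + 1 and let
-- the language consist of the inputs x in which no address with between 1 and d set bits
-- points to a 0. A deterministic machine checks these addresses by moving d nested marks along
-- the address tape, in O(log^(k+1) n) steps. A machine accepting within c·log^k n steps reads
-- at most that many cells of the all-ones input, which belongs to the language, so for large n
-- it misses one of the (log n / d)^d addresses having one set bit in each of d blocks of the
-- address; zeroing that cell yields an input outside the language that is still accepted.
module Submission where

open import Defs
open import Level using (0ℓ)
open import Data.Bool using (Bool; true; false; if_then_else_; T)
open import Data.Bool.Properties using (T-≡)
open import Data.Empty using (⊥; ⊥-elim)
open import Data.Fin as Fin using (Fin; #_; toℕ; fromℕ<; combine; finToFun; funToFin)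
open import Data.Fin.Properties
  using (toℕ-fromℕ<; toℕ<n; toℕ-injective; funToFin-finToFin; pigeonhole; ¬∀⟶∃¬)
open import Data.List using (List; []; _∷_; length; map; replicate; lookup)
open import Data.List.Properties using (length-replicate)
open import Data.List.Membership.Propositional using (_∈_)
import Data.List.Relation.Unary.Any as Any
open import Data.List.Relation.Unary.Any.Properties using (lookup-index)
open import Data.Nat
  using (ℕ; zero; suc; _+_; _*_; _∸_; _^_; _≤_; _<_; z≤n; s≤s; z<s; _<ᵇ_; _≡ᵇ_; _<?_; _≟_)
open import Data.Nat.Properties
open import Data.List.Membership.DecPropositional _≟_ using (_∈?_)
open import Data.Nat.Logarithm using (⌈log₂_⌉; ⌈log₂⌉-mono-≤; ⌈log₂2^n⌉≡n)
open import Data.Nat.Solver using (module +-*-Solver)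
open import Data.Product using (Σ; ∃; _×_; _,_; proj₁; proj₂)
open import Data.Sum using (_⊎_; inj₁; inj₂)
open import Data.Unit using (⊤; tt)
open import Function using (_∘_; Equivalence)
open import Relation.Binary.PropositionalEquality
open import Relation.Nullary using (¬_; yes; no; Dec; contradiction)
open import Relation.Unary using (Pred)

open +-*-Solver using (solve; _:+_; _:*_; _:=_; con)

-- Machines and time bounds

module _ (M : NRTM) where
  open NRTM M

  AccWithin-mono : ∀ {x m m' c} → m ≤ m' → AccWithin M x m c → AccWithin M x m' c
  AccWithin-mono _         (here acc)  = here acc
  AccWithin-mono (s≤s m≤m') (step c' a) = step c' (AccWithin-mono m≤m' a)

  private
    nextOn : ℕ → InSym → Config M → List (Config M)
    nextOn n s (config st w wp a ap) = map apply
      (δ st s (λ i → w i (wp i)) (readAddr (addrLen n) a ap))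
      where
      apply : Fin q × (Fin t → Fin (suc g) × Move) × (Bool × Move) → Config M
      apply (st' , act , (b , m)) =
        config st'
          (λ i → update (w i) (wp i) (proj₁ (act i)))
          (λ i → moveWork (proj₂ (act i)) (wp i))
          (writeAddr (addrLen n) a ap b)
          (moveAddr (addrLen n) m ap)

  addressOf : List Bool → Config M → ℕ
  addressOf x c = addrValue (addrLen (length x)) (Config.addr c)

  next-cong : ∀ x x' c → length x ≡ length x' →
              readIn x (addressOf x c) ≡ readIn x' (addressOf x c) → next M x c ≡ next M x' c
  next-cong x x' c |x|≡|x'| same-cell = begin
    next M x c                                       ≡⟨⟩
    nextOn (length x) (readIn x (addressOf x c)) c   ≡⟨ cong (λ s → nextOn (length x) s c) same-cell ⟩
    nextOn (length x) (readIn x' (addressOf x c)) c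
      ≡⟨ cong (λ n → nextOn n (readIn x' (address n)) c) |x|≡|x'| ⟩
    next M x' c                                      ∎
    where
    open ≡-Reasoning
    address : ℕ → ℕ
    address n = addrValue (addrLen n) (Config.addr c)

  AccWithin-queries : ∀ x {m c} → AccWithin M x m c →
    Σ (List ℕ) λ R → length R ≤ m ×
      (∀ x' → length x ≡ length x' → (∀ a → a ∈ R → readIn x a ≡ readIn x' a) →
              AccWithin M x' m c)
  AccWithin-queries x (here acc) = [] , z≤n , λ _ _ _ → here acc
  AccWithin-queries x {c = c} (step {c' = c'} c'∈next a) with AccWithin-queries x a
  ... | R , |R|≤m , transfer =
    addressOf x c ∷ R , s≤s |R|≤m ,
    λ x' |x|≡|x'| agree →
      step (subst (c' ∈_) (next-cong x x' c |x|≡|x'| (agree _ (Any.here refl))) c'∈next)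
           (transfer x' |x|≡|x'| (λ a a∈R → agree a (Any.there a∈R)))

NTIME-mono : ∀ {f g : ℕ → ℕ} {L} n₁ → (∀ n → n₁ ≤ n → f n ≤ g n) → NTIME f L → NTIME g L
NTIME-mono n₁ f≤g (M , c , n₀ , decides , fast) =
  M , c , n₀ + n₁ , decides ,
  λ x n₀+n₁≤|x| acc →
    AccWithin-mono M (*-monoʳ-≤ c (f≤g (length x) (≤-trans (m≤n+m n₁ n₀) n₀+n₁≤|x|)))
                     (fast x (≤-trans (m≤m+n n₀ n₁) n₀+n₁≤|x|) acc)

-- Tapes and addresses

Tape : Set
Tape = ℕ → Bool

bitValue : Bool → ℕ
bitValue b = if b then 1 else 0

bitValue-+-2*-injective : ∀ a b u v → bitValue a + 2 * u ≡ bitValue b + 2 * v → a ≡ b × u ≡ v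
bitValue-+-2*-injective false false u v e = refl , *-cancelˡ-≡ u v 2 e
bitValue-+-2*-injective true  true  u v e = refl , *-cancelˡ-≡ u v 2 (suc-injective e)
bitValue-+-2*-injective false true  u v e = contradiction e (even≢odd u v)
bitValue-+-2*-injective true  false u v e = contradiction (sym e) (even≢odd v u)

addrValue-cong : ∀ l (a b : Tape) → (∀ i → i < l → a i ≡ b i) → addrValue l a ≡ addrValue l b
addrValue-cong zero    a b a≈b = refl
addrValue-cong (suc l) a b a≈b =
  cong₂ (λ b₀ v → bitValue b₀ + 2 * v) (a≈b 0 (s≤s z≤n))
        (addrValue-cong l (a ∘ suc) (b ∘ suc) (λ i → a≈b (suc i) ∘ s≤s))

addrValue-injective : ∀ l (a b : Tape) → addrValue l a ≡ addrValue l b → ∀ i → i < l → a i ≡ b i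
addrValue-injective (suc l) a b e i i<l
  with bitValue-+-2*-injective (a 0) (b 0) (addrValue l (a ∘ suc)) (addrValue l (b ∘ suc)) e
... | a₀≡b₀ , rest with i | i<l
...   | zero  | _       = a₀≡b₀
...   | suc i | s≤s i<l = addrValue-injective l (a ∘ suc) (b ∘ suc) rest i i<l

addrValue<2^ : ∀ l (a : Tape) → addrValue l a < 2 ^ l
addrValue<2^ zero    a = s≤s z≤n
addrValue<2^ (suc l) a = begin-strict
  bitValue (a 0) + 2 * v  ≤⟨ +-monoˡ-≤ (2 * v) (bitValue≤1 (a 0)) ⟩
  1 + 2 * v               <⟨ n<1+n _ ⟩
  2 + 2 * v               ≡⟨ sym (*-suc 2 v) ⟩
  2 * suc v               ≤⟨ *-monoʳ-≤ 2 (addrValue<2^ l (a ∘ suc)) ⟩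
  2 * 2 ^ l               ∎
  where
  open ≤-Reasoning
  v = addrValue l (a ∘ suc)
  bitValue≤1 : ∀ b → bitValue b ≤ 1
  bitValue≤1 false = z≤n
  bitValue≤1 true  = s≤s z≤n

<⇒<ᵇ≡true : ∀ {m n} → m < n → (m <ᵇ n) ≡ true
<⇒<ᵇ≡true m<n = Equivalence.to T-≡ (<⇒<ᵇ m<n)

≮⇒<ᵇ≡false : ∀ {m n} → ¬ m < n → (m <ᵇ n) ≡ false
≮⇒<ᵇ≡false {m} {n} m≮n with m <ᵇ n in m<ᵇn
... | false = refl
... | true  = contradiction (<ᵇ⇒< m n (Equivalence.from T-≡ m<ᵇn)) m≮n

≡⇒≡ᵇ≡true : ∀ n → (n ≡ᵇ n) ≡ true
≡⇒≡ᵇ≡true n = Equivalence.to T-≡ (≡⇒≡ᵇ n n refl)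

≡ᵇ≡true⇒≡ : ∀ {m n} → (m ≡ᵇ n) ≡ true → m ≡ n
≡ᵇ≡true⇒≡ {m} {n} m≡ᵇn = ≡ᵇ⇒≡ m n (Equivalence.from T-≡ m≡ᵇn)

≢⇒≡ᵇ≡false : ∀ {m n} → m ≢ n → (m ≡ᵇ n) ≡ false
≢⇒≡ᵇ≡false {m} {n} m≢n with m ≡ᵇ n in m≡ᵇn
... | false = refl
... | true  = contradiction (≡ᵇ≡true⇒≡ m≡ᵇn) m≢n

update-self : ∀ (τ : Tape) h b → τ h ≡ b → ∀ i → update τ h b i ≡ τ i
update-self τ h b τh≡b i with i ≡ᵇ h in i≡ᵇh
... | true  = trans (sym τh≡b) (cong τ (sym (≡ᵇ≡true⇒≡ i≡ᵇh)))
... | false = refl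

update-at : ∀ (τ : Tape) h b → update τ h b h ≡ b
update-at τ h b rewrite ≡⇒≡ᵇ≡true h = refl

update-other : ∀ (τ : Tape) {h i} b → i ≢ h → update τ h b i ≡ τ i
update-other τ b i≢h rewrite ≢⇒≡ᵇ≡false i≢h = refl

update-update : ∀ (τ : Tape) h b b' → τ h ≡ b' → ∀ i → update (update τ h b) h b' i ≡ τ i
update-update τ h b b' τh≡b' i with i ≡ᵇ h in i≡ᵇh
... | true  = trans (sym τh≡b') (cong τ (sym (≡ᵇ≡true⇒≡ i≡ᵇh)))
... | false = refl

setBit : Tape → ℕ → Tape
setBit τ q = update τ q true

place : ∀ B j → ℕ → Tape → (Fin j → Fin B) → Tape
place B zero    q τ f = τ
place B (suc j) q τ f = place B j (q + B) (setBit τ (q + toℕ (f Fin.zero))) (f ∘ Fin.suc)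

place-below : ∀ B j q τ f p → p < q → place B j q τ f p ≡ τ p
place-below B zero    q τ f p p<q = refl
place-below B (suc j) q τ f p p<q =
  trans (place-below B j (q + B) _ (f ∘ Fin.suc) p (<-≤-trans p<q (m≤m+n q B)))
        (update-other τ true (<⇒≢ (<-≤-trans p<q (m≤m+n q _))))

place-injective : ∀ B j q τ → (∀ p → q ≤ p → τ p ≡ false) → ∀ f f' →
                  (∀ p → p < q + j * B → place B j q τ f p ≡ place B j q τ f' p) →
                  ∀ k → f k ≡ f' k
place-injective B (suc j) q τ clear f f' same Fin.zero = toℕ-injective first
  where
  a = toℕ (f Fin.zero)
  a' = toℕ (f' Fin.zero)
  q+a<q+B : q + a < q + B
  q+a<q+B = +-monoʳ-< q (toℕ<n (f Fin.zero))
  first : a ≡ a'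
  first with a ≟ a'
  ... | yes a≡a' = a≡a'
  ... | no  a≢a' = contradiction (begin
    true                            ≡⟨ sym (update-at τ (q + a) true) ⟩
    setBit τ (q + a) (q + a)        ≡⟨ sym (place-below B j (q + B) _ _ (q + a) q+a<q+B) ⟩
    place B (suc j) q τ f (q + a)   ≡⟨ same (q + a) (<-≤-trans q+a<q+B (+-monoʳ-≤ q (m≤m+n B (j * B)))) ⟩
    place B (suc j) q τ f' (q + a)  ≡⟨ place-below B j (q + B) _ _ (q + a) q+a<q+B ⟩
    setBit τ (q + a') (q + a)       ≡⟨ update-other τ true (a≢a' ∘ +-cancelˡ-≡ q a a') ⟩
    τ (q + a)                       ≡⟨ clear (q + a) (m≤m+n q a) ⟩
    false                           ∎) λ ()
    where open ≡-Reasoning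
place-injective B (suc j) q τ clear f f' same (Fin.suc k) =
  place-injective B j (q + B) τ₁ clear₁ (f ∘ Fin.suc) (f' ∘ Fin.suc) same₁ k
  where
  τ₁ = setBit τ (q + toℕ (f Fin.zero))
  clear₁ : ∀ p → q + B ≤ p → τ₁ p ≡ false
  clear₁ p q+B≤p =
    trans (update-other τ true (>⇒≢ (<-≤-trans (+-monoʳ-< q (toℕ<n (f Fin.zero))) q+B≤p)))
          (clear p (≤-trans (m≤m+n q B) q+B≤p))
  same₁ : ∀ p → p < q + B + j * B →
          place B j (q + B) τ₁ (f ∘ Fin.suc) p ≡ place B j (q + B) τ₁ (f' ∘ Fin.suc) p
  same₁ p p< =
    subst (λ a → place B j (q + B) τ₁ (f ∘ Fin.suc) p ≡ place B j (q + B) (setBit τ (q + toℕ a)) (f' ∘ Fin.suc) p)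
          (sym (place-injective B (suc j) q τ clear f f' same Fin.zero))
          (same p (subst (p <_) (+-assoc q B (j * B)) p<))

funToFin-cong : ∀ {m n} {f g : Fin m → Fin n} → (∀ k → f k ≡ g k) → funToFin f ≡ funToFin g
funToFin-cong {zero}  f≗g = refl
funToFin-cong {suc m} f≗g = cong₂ combine (f≗g Fin.zero) (funToFin-cong (f≗g ∘ Fin.suc))

finToFun-injective : ∀ {m n} (i i' : Fin (m ^ n)) → (∀ k → finToFun {m} {n} i k ≡ finToFun i' k) →
                     i ≡ i'
finToFun-injective {m} {n} i i' same =
  trans (sym (funToFin-finToFin {n} {m} i)) (trans (funToFin-cong same) (funToFin-finToFin {n} {m} i'))

-- Inputs and counting

onesExcept : ℕ → ℕ → List Bool
onesExcept zero    a       = []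
onesExcept (suc n) zero    = false ∷ replicate n true
onesExcept (suc n) (suc a) = true ∷ onesExcept n a

length-onesExcept : ∀ n a → length (onesExcept n a) ≡ n
length-onesExcept zero    a       = refl
length-onesExcept (suc n) zero    = cong suc (length-replicate n)
length-onesExcept (suc n) (suc a) = cong suc (length-onesExcept n a)

readIn-ones : ∀ n a → readIn (replicate n true) a ≢ bit false
readIn-ones zero    a       ()
readIn-ones (suc n) zero    ()
readIn-ones (suc n) (suc a) = readIn-ones n a

readIn-onesExcept-at : ∀ n a → a < n → readIn (onesExcept n a) a ≡ bit false
readIn-onesExcept-at (suc n) zero    _         = refl
readIn-onesExcept-at (suc n) (suc a) (s≤s a<n) = readIn-onesExcept-at n a a<n

readIn-onesExcept-other : ∀ n a b → b ≢ a → readIn (replicate n true) b ≡ readIn (onesExcept n a) b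
readIn-onesExcept-other zero    a       b       b≢a = refl
readIn-onesExcept-other (suc n) zero    zero    b≢a = contradiction refl b≢a
readIn-onesExcept-other (suc n) zero    (suc b) b≢a = refl
readIn-onesExcept-other (suc n) (suc a) zero    b≢a = refl
readIn-onesExcept-other (suc n) (suc a) (suc b) b≢a = readIn-onesExcept-other n a b (b≢a ∘ cong suc)

¬≢0⇒≡0 : ∀ s → ¬ s ≢ bit false → s ≡ bit false
¬≢0⇒≡0 (bit false) _    = refl
¬≢0⇒≡0 (bit true)  ¬s≢0 = contradiction (λ ()) ¬s≢0
¬≢0⇒≡0 endmark     ¬s≢0 = contradiction (λ ()) ¬s≢0

injective-avoids-short-list : ∀ N (f : Fin N → ℕ) → (∀ i j → f i ≡ f j → i ≡ j) →
                              (R : List ℕ) → length R < N → ∃ λ i → ¬ f i ∈ R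
injective-avoids-short-list N f f-inj R |R|<N = ¬∀⟶∃¬ N (λ i → f i ∈ R) (λ i → f i ∈? R) all-in
  where
  all-in : ¬ (∀ i → f i ∈ R)
  all-in f∈R with pigeonhole |R|<N (λ i → Any.index (f∈R i))
  ... | i , j , i<j , same-index = <-irrefl (cong toℕ (f-inj i j f-i≡f-j)) i<j
    where
    f-i≡f-j : f i ≡ f j
    f-i≡f-j = trans (lookup-index (f∈R i)) (trans (cong (lookup R) same-index) (sym (lookup-index (f∈R j))))

n<2^n : ∀ n → n < 2 ^ n
n<2^n zero    = s≤s z≤n
n<2^n (suc n) = begin-strict
  suc n        <⟨ s≤s (n<2^n n) ⟩
  suc (2 ^ n)  ≤⟨ +-monoˡ-≤ (2 ^ n) (m^n>0 2 n) ⟩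
  2 ^ n + 2 ^ n ≡⟨ cong (2 ^ n +_) (sym (+-identityʳ (2 ^ n))) ⟩
  2 * 2 ^ n    ∎
  where open ≤-Reasoning

*-^-distrib : ∀ a b n → (a * b) ^ n ≡ a ^ n * b ^ n
*-^-distrib a b zero    = refl
*-^-distrib a b (suc n) rewrite *-^-distrib a b n =
  solve 4 (λ a b x y → (a :* b) :* (x :* y) := (a :* x) :* (b :* y)) refl a b (a ^ n) (b ^ n)

-- The enumeration machine

data Phase : Set where
  mark query probe advance advanced unmark scan accept : Phase

State : Set
State = Phase × ℕ

phaseIndex : Phase → Fin 8
phaseIndex mark     = # 0
phaseIndex query    = # 1
phaseIndex probe    = # 2
phaseIndex advance  = # 3
phaseIndex advanced = # 4
phaseIndex unmark   = # 5
phaseIndex scan     = # 6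
phaseIndex accept   = # 7

encode : State → ℕ
encode (p , j) = toℕ (phaseIndex p) + j * 8

decode : ℕ → State
decode 0 = mark , 0
decode 1 = query , 0
decode 2 = probe , 0
decode 3 = advance , 0
decode 4 = advanced , 0
decode 5 = unmark , 0
decode 6 = scan , 0
decode 7 = accept , 0
decode (suc (suc (suc (suc (suc (suc (suc (suc n)))))))) with decode n
... | p , j = p , suc j

encode-suc : ∀ p j → encode (p , suc j) ≡ 8 + encode (p , j)
encode-suc p j =
  solve 2 (λ i j → i :+ (con 8 :+ j :* con 8) := con 8 :+ (i :+ j :* con 8)) refl (toℕ (phaseIndex p)) j

decode-encode : ∀ p j → decode (encode (p , j)) ≡ (p , j)
decode-encode mark     zero = refl
decode-encode query    zero = refl
decode-encode probe    zero = refl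
decode-encode advance  zero = refl
decode-encode advanced zero = refl
decode-encode unmark   zero = refl
decode-encode scan     zero = refl
decode-encode accept   zero = refl
decode-encode p        (suc j) rewrite encode-suc p j | decode-encode p j = refl

isAccept : Phase → Bool
isAccept accept = true
isAccept _      = false

-- The address tape holds marks p_d < p_(d-1) < ... < p_j. Level j moves its mark through the
-- cells to the right of p_(j+1), querying the input at each resulting address (a 0 rejects);
-- for j > 1, after each query it runs level j - 1 to the right of p_j and then scans back to
-- p_j. A level ends when its mark cannot move right; the top level then accepts.
module Enumerator (d : ℕ) where

  Q : ℕ
  Q = suc d * 8

  -- Out-of-range codes are sent to state 0; the transitions only produce codes below Q.
  toState : ℕ → Fin Q
  toState n with n <? Q
  ... | yes n<Q = fromℕ< n<Q
  ... | no  _   = Fin.zero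

  toℕ-toState : ∀ {n} → n < Q → toℕ (toState n) ≡ n
  toℕ-toState {n} n<Q with n <? Q
  ... | yes n<Q′ = toℕ-fromℕ< n<Q′
  ... | no  n≮Q  = contradiction n<Q n≮Q

  encode<Q : ∀ p {j} → j ≤ d → encode (p , j) < Q
  encode<Q p j≤d = +-mono-<-≤ (toℕ<n (phaseIndex p)) (*-monoˡ-≤ 8 j≤d)

  afterLevel : ℕ → State
  afterLevel j = if j ≡ᵇ d then (accept , 0) else (scan , suc j)

  transition : State → InSym → Bool → List (State × Bool × Move)
  transition (mark , j)                 _           _     = ((query , j) , true , stay) ∷ []
  transition (query , j)                (bit false) _     = []
  transition (query , zero)             _           _     = []
  transition (query , suc zero)         _           _     = ((advance , 1) , true , stay) ∷ []
  transition (query , suc (suc i))      _           _     = ((probe , suc (suc i)) , true , right) ∷ []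
  transition (probe , j)                _           false = ((mark , j ∸ 1) , false , stay) ∷ []
  transition (probe , j)                _           true  = ((advance , j) , true , stay) ∷ []
  transition (advance , j)              _           _     = ((advanced , j) , true , right) ∷ []
  transition (advanced , j)             _           false = ((unmark , j) , false , left) ∷ []
  transition (advanced , j)             _           true  = (afterLevel j , false , stay) ∷ []
  transition (unmark , j)               _           _     = ((mark , j) , false , right) ∷ []
  transition (scan , j)                 _           false = ((scan , j) , false , left) ∷ []
  transition (scan , j)                 _           true  = ((advance , j) , true , stay) ∷ []
  transition (accept , _)               _           _     = []

  Action : Set
  Action = Fin Q × (Fin 0 → Fin 1 × Move) × (Bool × Move)

  transition-query-good : ∀ j s b → s ≢ bit false →
                          transition (query , j) s b ≡ transition (query , j) endmark b
  transition-query-good j             (bit false) b s≢0 = contradiction refl s≢0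
  transition-query-good zero          (bit true)  b s≢0 = refl
  transition-query-good (suc zero)    (bit true)  b s≢0 = refl
  transition-query-good (suc (suc i)) (bit true)  b s≢0 = refl
  transition-query-good j             endmark     b s≢0 = refl

  toAction : State × Bool × Move → Action
  toAction (s , b , m) = toState (encode s) , (λ ()) , (b , m)

  afterLevel<Q : ∀ {j} → j ≤ d → encode (afterLevel j) < Q
  afterLevel<Q {j} j≤d with j ≡ᵇ d in j≡ᵇd
  ... | true  = encode<Q accept z≤n
  ... | false = encode<Q scan (≤∧≢⇒< j≤d λ j≡d → subst T j≡ᵇd (≡⇒≡ᵇ j d j≡d))

  afterLevel-below : ∀ {j} → j < d → afterLevel j ≡ (scan , suc j)
  afterLevel-below {j} j<d rewrite ≢⇒≡ᵇ≡false (<⇒≢ j<d) = refl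

  afterLevel-top : afterLevel d ≡ (accept , 0)
  afterLevel-top rewrite ≡⇒≡ᵇ≡true d = refl

  machine : NRTM
  machine = record
    { q         = Q
    ; g         = 0
    ; t         = 0
    ; start     = toState (encode (mark , d))
    ; accepting = λ s → isAccept (proj₁ (decode (toℕ s)))
    ; δ         = λ s σ _ b → map toAction (transition (decode (toℕ s)) σ b)
    }

EnumLang : ℕ → Pred (List Bool) 0ℓ
EnumLang d = Accepts (Enumerator.machine d)

-- Runs of the machine

module Simulation (d : ℕ) (x : List Bool) where
  open Enumerator d

  L : ℕ
  L = addrLen (length x)

  -- The machine has no work tapes; only the first L cells of the address tape are visible.
  record Snapshot : Set where
    constructor ⟨_,_,_⟩
    field
      state : State
      head  : ℕ
      tape  : Tape

  Matches : Snapshot → Config machine → Set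
  Matches ⟨ s , h , τ ⟩ c =
    toℕ (Config.state c) ≡ encode s × Config.apos c ≡ h × (∀ i → i < L → Config.addr c i ≡ τ i)

  private
    applyAction : Config machine → Action → Config machine
    applyAction (config s w wp a ap) (s' , act , (b , m)) =
      config s' (λ i → update (w i) (wp i) (proj₁ (act i))) (λ i → moveWork (proj₂ (act i)) (wp i))
        (writeAddr L a ap b) (moveAddr L m ap)

  next-Matches : ∀ {s h τ} c → Matches ⟨ s , h , τ ⟩ c → h < L →
    next machine x c ≡ map (applyAction c) (map toAction (transition s (readIn x (addrValue L τ)) (τ h)))
  next-Matches {s} {h} {τ} c (state≡ , head≡ , tape≈) h<L = begin
    next machine x c
      ≡⟨⟩
    successors (decode (toℕ (Config.state c))) (readIn x (addrValue L (Config.addr c))) headBit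
      ≡⟨ cong (λ s′ → successors s′ _ _) (trans (cong decode state≡) (decode-encode (proj₁ s) (proj₂ s))) ⟩
    successors s (readIn x (addrValue L (Config.addr c))) headBit
      ≡⟨ cong (λ σ → successors s σ _) (cong (readIn x) (addrValue-cong L _ _ tape≈)) ⟩
    successors s (readIn x (addrValue L τ)) headBit
      ≡⟨ cong (successors s _) bit≡ ⟩
    successors s (readIn x (addrValue L τ)) (τ h)
      ∎
    where
    open ≡-Reasoning
    successors : State → InSym → Bool → List (Config machine)
    successors s σ b = map (applyAction c) (map toAction (transition s σ b))
    headBit = readAddr L (Config.addr c) (Config.apos c)
    bit≡ : headBit ≡ τ h
    bit≡ rewrite head≡ | <⇒<ᵇ≡true h<L = tape≈ h h<L

  Accepting : ℕ → Snapshot → Set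
  Accepting m A = ∀ c → Matches A c → AccWithin machine x m c

  Rejecting : Snapshot → Set
  Rejecting A = ∀ m c → Matches A c → ¬ AccWithin machine x m c

  -- The machine is deterministic on these runs: every accepting computation from A passes through B.
  record Run (A B : Snapshot) : Set where
    field
      cost     : ℕ
      forward  : ∀ m → Accepting m B → Accepting (cost + m) A
      backward : ∀ m c → Matches A c → AccWithin machine x m c →
                 ∃ λ m' → ∃ λ c' → Matches B c' × AccWithin machine x m' c'
  open Run public

  infixr 5 _⨾_
  _⨾_ : ∀ {A B C} → Run A B → Run B C → Run A C
  cost (r₁ ⨾ r₂) = cost r₁ + cost r₂
  forward (r₁ ⨾ r₂) m accC c c≈A =
    subst (λ n → AccWithin machine x n c) (sym (+-assoc (cost r₁) (cost r₂) m))
      (forward r₁ (cost r₂ + m) (forward r₂ m accC) c c≈A)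
  backward (r₁ ⨾ r₂) m c c≈A acc with backward r₁ m c c≈A acc
  ... | m' , c' , c'≈B , acc' = backward r₂ m' c' c'≈B acc'

  Run-retarget : ∀ {A B B'} → B ≡ B' → Run A B → Run A B'
  cost (Run-retarget B≡B' r) = cost r
  forward (Run-retarget B≡B' r) m accB' = forward r m (subst (Accepting m) (sym B≡B') accB')
  backward (Run-retarget B≡B' r) m c c≈A acc with backward r m c c≈A acc
  ... | m' , c' , c'≈B , acc' = m' , c' , subst (λ B → Matches B c') B≡B' c'≈B , acc'

  RunWithin : Snapshot → Snapshot → ℕ → Set
  RunWithin A B n = Σ (Run A B) λ r → cost r ≤ n

  infixr 5 _⨾≤_
  _⨾≤_ : ∀ {A B C a b} → RunWithin A B a → RunWithin B C b → RunWithin A C (a + b)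
  (r₁ , r₁≤) ⨾≤ (r₂ , r₂≤) = r₁ ⨾ r₂ , +-mono-≤ r₁≤ r₂≤

  RunWithin-head : ∀ {A s h h' τ n} → h ≡ h' →
                   RunWithin A ⟨ s , h , τ ⟩ n → RunWithin A ⟨ s , h' , τ ⟩ n
  RunWithin-head h≡h' (r , r≤) = Run-retarget (cong (λ h → ⟨ _ , h , _ ⟩) h≡h') r , r≤

  Rejecting-backward : ∀ {A B} → Run A B → Rejecting B → Rejecting A
  Rejecting-backward r rejB m c c≈A acc with backward r m c c≈A acc
  ... | m' , c' , c'≈B , acc' = rejB m' c' c'≈B acc'

  accepting-Matches : ∀ {s h τ} c → Matches ⟨ s , h , τ ⟩ c →
                      NRTM.accepting machine (Config.state c) ≡ isAccept (proj₁ s)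
  accepting-Matches {s} c (state≡ , _) =
    cong (isAccept ∘ proj₁) (trans (cong decode state≡) (decode-encode (proj₁ s) (proj₂ s)))

  private
    not-accepting : ∀ {s h τ} c → Matches ⟨ s , h , τ ⟩ c → isAccept (proj₁ s) ≡ false →
                    NRTM.accepting machine (Config.state c) ≡ false
    not-accepting {s} {h} {τ} c c≈A s≢accept = trans (accepting-Matches {s} {h} {τ} c c≈A) s≢accept

  step-Run : ∀ {s h τ s' h' τ' b mv} → isAccept (proj₁ s) ≡ false → h < L →
             transition s (readIn x (addrValue L τ)) (τ h) ≡ (s' , b , mv) ∷ [] →
             encode s' < Q → moveAddr L mv h ≡ h' → (∀ i → update τ h b i ≡ τ' i) →
             Run ⟨ s , h , τ ⟩ ⟨ s' , h' , τ' ⟩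
  step-Run {s} {h} {τ} {s'} {h'} {τ'} {b} {mv} s≢accept h<L δ≡ s'<Q move≡ write≈ = record
    { cost     = 1
    ; forward  = λ m accB c c≈A → step (successor∈ c c≈A) (accB _ (successor≈ c c≈A))
    ; backward = backward′
    }
    where
    successor : Config machine → Config machine
    successor c = applyAction c (toAction (s' , b , mv))

    next≡ : ∀ c → Matches ⟨ s , h , τ ⟩ c → next machine x c ≡ successor c ∷ []
    next≡ c c≈A = trans (next-Matches c c≈A h<L) (cong (map (applyAction c) ∘ map toAction) δ≡)

    successor∈ : ∀ c → Matches ⟨ s , h , τ ⟩ c → successor c ∈ next machine x c
    successor∈ c c≈A = subst (successor c ∈_) (sym (next≡ c c≈A)) (Any.here refl)

    successor≈ : ∀ c → Matches ⟨ s , h , τ ⟩ c → Matches ⟨ s' , h' , τ' ⟩ (successor c)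
    successor≈ c (_ , head≡ , tape≈) = toℕ-toState s'<Q , trans (cong (moveAddr L mv) head≡) move≡ , tape′
      where
      tape′ : ∀ i → i < L → writeAddr L (Config.addr c) (Config.apos c) b i ≡ τ' i
      tape′ i i<L rewrite head≡ | <⇒<ᵇ≡true h<L = trans update≈ (write≈ i)
        where
        update≈ : update (Config.addr c) h b i ≡ update τ h b i
        update≈ with i ≡ᵇ h
        ... | true  = refl
        ... | false = tape≈ i i<L

    backward′ : ∀ m c → Matches ⟨ s , h , τ ⟩ c → AccWithin machine x m c →
                ∃ λ m' → ∃ λ c' → Matches ⟨ s' , h' , τ' ⟩ c' × AccWithin machine x m' c'
    backward′ m c c≈A (here acc) =
      contradiction (trans (sym acc) (not-accepting {s} {h} {τ} c c≈A s≢accept)) λ ()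
    backward′ m c c≈A (step {m = m'} {c' = c'} c'∈next acc)
      with subst (c' ∈_) (next≡ c c≈A) c'∈next
    ... | Any.here refl = m' , c' , successor≈ c c≈A , acc

  step-Rejecting : ∀ {s h τ} → isAccept (proj₁ s) ≡ false → h < L →
                   transition s (readIn x (addrValue L τ)) (τ h) ≡ [] → Rejecting ⟨ s , h , τ ⟩
  step-Rejecting {s} {h} {τ} s≢accept h<L δ≡ m c c≈A (here acc) =
    contradiction (trans (sym acc) (not-accepting {s} {h} {τ} c c≈A s≢accept)) λ ()
  step-Rejecting s≢accept h<L δ≡ m c c≈A (step {c' = c'} c'∈next _)
    with subst (c' ∈_) (trans (next-Matches c c≈A h<L) (cong (map (applyAction c) ∘ map toAction) δ≡))
               c'∈next
  ... | ()

  Good : Tape → Set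
  Good τ = readIn x (addrValue L τ) ≢ bit false

  good? : ∀ τ → Dec (Good τ)
  good? τ with readIn x (addrValue L τ)
  ... | bit false = no λ ≢0 → ≢0 refl
  ... | bit true  = yes λ ()
  ... | endmark   = yes λ ()

  -- AllGood i q τ: each address reached from τ by setting up to i more bits, at increasing
  -- positions from q on, reads a cell other than 0.
  AllGood : ℕ → ℕ → Tape → Set
  AllGood zero    q τ = ⊤
  AllGood (suc i) q τ = ∀ q' → q ≤ q' → q' < L → Good (setBit τ q') × AllGood i (suc q') (setBit τ q')

  AllGood-mono : ∀ {i q q' τ} → q ≤ q' → AllGood (suc i) q τ → AllGood (suc i) q' τ
  AllGood-mono q≤q' all q'' q'≤q'' = all q'' (≤-trans q≤q' q'≤q'')

  AllGood-cons : ∀ {i q τ} → Good (setBit τ q) → AllGood i (suc q) (setBit τ q) →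
                 AllGood (suc i) (suc q) τ → AllGood (suc i) q τ
  AllGood-cons good all all' q' q≤q' q'<L with m≤n⇒m<n∨m≡n q≤q'
  ... | inj₁ q<q' = all' q' q<q' q'<L
  ... | inj₂ refl = good , all

  AllGood-beyond : ∀ i {q τ} → L ≤ q → AllGood i q τ
  AllGood-beyond zero    L≤q = tt
  AllGood-beyond (suc i) L≤q q' q≤q' q'<L = contradiction (≤-trans L≤q q≤q') (<⇒≱ q'<L)

  ClearFrom : ℕ → Tape → Set
  ClearFrom q τ = ∀ i → q ≤ i → i < L → τ i ≡ false

  ClearFrom-suc : ∀ {q τ} → ClearFrom q τ → ClearFrom (suc q) τ
  ClearFrom-suc {q} clear i q<i = clear i (<⇒≤ q<i)

  ClearFrom-setBit : ∀ {q τ} → ClearFrom q τ → ClearFrom (suc q) (setBit τ q)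
  ClearFrom-setBit {q} {τ} clear i q<i i<L = trans (update-other τ true (>⇒≢ q<i)) (clear i (<⇒≤ q<i) i<L)

  setBit-next : ∀ {q τ} → ClearFrom q τ → suc q < L → setBit τ q (suc q) ≡ false
  setBit-next {q} {τ} clear sq<L = trans (update-other τ true (>⇒≢ (n<1+n q))) (clear (suc q) (n≤1+n q) sq<L)

  moveAddr-right : ∀ {h} → suc h < L → moveAddr L right h ≡ suc h
  moveAddr-right sh<L rewrite <⇒<ᵇ≡true sh<L = refl

  moveAddr-right-blocked : ∀ {h} → suc h ≡ L → moveAddr L right h ≡ h
  moveAddr-right-blocked sh≡L rewrite ≮⇒<ᵇ≡false (<-irrefl sh≡L) = refl

  cell<L : ∀ {q n} → q + suc n ≡ L → q < L
  cell<L {q} eq = subst (q <_) eq (m<m+n q z<s)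

  next-cell : ∀ {q n} → q + suc (suc n) ≡ L → suc q + suc n ≡ L
  next-cell {q} {n} eq = trans (sym (+-suc q (suc n))) eq

  last-cell : ∀ {q} → q + 1 ≡ L → suc q ≡ L
  last-cell {q} eq = trans (+-comm 1 q) eq

  mark-step : ∀ {j q τ} → j ≤ d → q < L →
              Run ⟨ (mark , j) , q , τ ⟩ ⟨ (query , j) , q , setBit τ q ⟩
  mark-step j≤d q<L = step-Run refl q<L refl (encode<Q query j≤d) refl (λ _ → refl)

  query-step₁ : ∀ {q σ} → Good σ → σ q ≡ true → 1 ≤ d → q < L →
                Run ⟨ (query , 1) , q , σ ⟩ ⟨ (advance , 1) , q , σ ⟩
  query-step₁ {q} {σ} good σq 1≤d q<L =
    step-Run refl q<L (transition-query-good 1 _ _ good) (encode<Q advance 1≤d) refl (update-self σ q true σq)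

  query-step₊ : ∀ {i q h' σ} → Good σ → σ q ≡ true → suc (suc i) ≤ d → q < L →
                moveAddr L right q ≡ h' →
                Run ⟨ (query , suc (suc i)) , q , σ ⟩ ⟨ (probe , suc (suc i)) , h' , σ ⟩
  query-step₊ {i} {q} {h'} {σ} good σq j≤d q<L move≡ =
    step-Run refl q<L (transition-query-good (suc (suc i)) _ _ good) (encode<Q probe j≤d) move≡
      (update-self σ q true σq)

  query-rejects : ∀ {j q σ} → ¬ Good σ → q < L → Rejecting ⟨ (query , j) , q , σ ⟩
  query-rejects {j} {q} {σ} bad q<L =
    step-Rejecting refl q<L (cong (λ s → transition (query , j) s (σ q)) (¬≢0⇒≡0 _ bad))

  probe-free-step : ∀ {i h σ} → σ h ≡ false → suc i ≤ d → h < L →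
                    Run ⟨ (probe , suc (suc i)) , h , σ ⟩ ⟨ (mark , suc i) , h , σ ⟩
  probe-free-step {i} {h} {σ} σh j≤d h<L =
    step-Run refl h<L (cong (transition (probe , suc (suc i)) _) σh) (encode<Q mark j≤d) refl
      (update-self σ h false σh)

  probe-blocked-step : ∀ {j h σ} → σ h ≡ true → j ≤ d → h < L →
                       Run ⟨ (probe , j) , h , σ ⟩ ⟨ (advance , j) , h , σ ⟩
  probe-blocked-step {j} {h} {σ} σh j≤d h<L =
    step-Run refl h<L (cong (transition (probe , j) _) σh) (encode<Q advance j≤d) refl (update-self σ h true σh)

  advance-step : ∀ {j h h' σ} → σ h ≡ true → j ≤ d → h < L → moveAddr L right h ≡ h' →
                 Run ⟨ (advance , j) , h , σ ⟩ ⟨ (advanced , j) , h' , σ ⟩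
  advance-step {j} {h} {h'} {σ} σh j≤d h<L move≡ =
    step-Run refl h<L refl (encode<Q advanced j≤d) move≡ (update-self σ h true σh)

  advanced-free-step : ∀ {j q σ} → σ (suc q) ≡ false → j ≤ d → suc q < L →
                       Run ⟨ (advanced , j) , suc q , σ ⟩ ⟨ (unmark , j) , q , σ ⟩
  advanced-free-step {j} {q} {σ} σsq j≤d sq<L =
    step-Run refl sq<L (cong (transition (advanced , j) _) σsq) (encode<Q unmark j≤d) refl
      (update-self σ (suc q) false σsq)

  advanced-blocked-step : ∀ {j q τ} → τ q ≡ false → j ≤ d → q < L →
                          Run ⟨ (advanced , j) , q , setBit τ q ⟩ ⟨ afterLevel j , q , τ ⟩
  advanced-blocked-step {j} {q} {τ} τq j≤d q<L =
    step-Run refl q<L (cong (transition (advanced , j) _) (update-at τ q true)) (afterLevel<Q j≤d) refl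
      (update-update τ q true false τq)

  unmark-step : ∀ {j q τ} → τ q ≡ false → j ≤ d → suc q < L →
                Run ⟨ (unmark , j) , q , setBit τ q ⟩ ⟨ (mark , j) , suc q , τ ⟩
  unmark-step {j} {q} {τ} τq j≤d sq<L =
    step-Run refl (<-trans (n<1+n q) sq<L) refl (encode<Q mark j≤d) (moveAddr-right sq<L)
      (update-update τ q true false τq)

  scan-run : ∀ {j q σ} dist → j ≤ d → dist + q < L → σ q ≡ true →
             (∀ t → t < dist → σ (suc t + q) ≡ false) →
             Run ⟨ (scan , j) , dist + q , σ ⟩ ⟨ (advance , j) , q , σ ⟩
  scan-run {j} {q} {σ} zero j≤d q<L σq _ =
    step-Run refl q<L (cong (transition (scan , j) _) σq) (encode<Q advance j≤d) refl (update-self σ q true σq)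
  scan-run {j} {q} {σ} (suc dist) j≤d h<L σq clear =
    step-Run refl h<L (cong (transition (scan , j) _) σh) (encode<Q scan j≤d) refl (update-self σ _ false σh)
    ⨾ scan-run dist j≤d (<-trans (n<1+n _) h<L) σq (λ t t<dist → clear t (<-trans t<dist (n<1+n dist)))
    where
    σh : σ (suc dist + q) ≡ false
    σh = clear dist (n<1+n dist)

  cost-scan-run : ∀ {j q σ} dist j≤d h<L σq clear →
                  cost (scan-run {j} {q} {σ} dist j≤d h<L σq clear) ≡ suc dist
  cost-scan-run zero       j≤d h<L σq clear = refl
  cost-scan-run (suc dist) j≤d h<L σq clear = cong suc (cost-scan-run dist j≤d _ σq _)

  mark-query₁ : ∀ {q τ} → Good (setBit τ q) → 1 ≤ d → q < L →
                Run ⟨ (mark , 1) , q , τ ⟩ ⟨ (advance , 1) , q , setBit τ q ⟩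
  mark-query₁ {q} {τ} good 1≤d q<L = mark-step 1≤d q<L ⨾ query-step₁ good (update-at τ q true) 1≤d q<L

  descend : ∀ {i q τ} → Good (setBit τ q) → suc (suc i) ≤ d → suc q < L → ClearFrom q τ →
            Run ⟨ (mark , suc (suc i)) , q , τ ⟩ ⟨ (mark , suc i) , suc q , setBit τ q ⟩
  descend {i} {q} {τ} good j≤d sq<L clear =
    mark-step j≤d q<L ⨾ query-step₊ good (update-at τ q true) j≤d q<L (moveAddr-right sq<L) ⨾
    probe-free-step (setBit-next clear sq<L) (≤-trans (n≤1+n _) j≤d) sq<L
    where
    q<L : q < L
    q<L = <-trans (n<1+n q) sq<L

  mark-query₊-blocked : ∀ {i q τ} → Good (setBit τ q) → suc (suc i) ≤ d → suc q ≡ L →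
                        Run ⟨ (mark , suc (suc i)) , q , τ ⟩ ⟨ (advance , suc (suc i)) , q , setBit τ q ⟩
  mark-query₊-blocked {i} {q} {τ} good j≤d sq≡L =
    mark-step j≤d q<L ⨾ query-step₊ good (update-at τ q true) j≤d q<L (moveAddr-right-blocked sq≡L) ⨾
    probe-blocked-step (update-at τ q true) j≤d q<L
    where
    q<L : q < L
    q<L = subst (q <_) sq≡L (n<1+n q)

  shift : ∀ {j q τ} → ClearFrom q τ → j ≤ d → suc q < L →
          Run ⟨ (advance , j) , q , setBit τ q ⟩ ⟨ (mark , j) , suc q , τ ⟩
  shift {j} {q} {τ} clear j≤d sq<L =
    advance-step (update-at τ q true) j≤d q<L (moveAddr-right sq<L) ⨾
    advanced-free-step (setBit-next clear sq<L) j≤d sq<L ⨾ unmark-step (clear q ≤-refl q<L) j≤d sq<L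
    where
    q<L : q < L
    q<L = <-trans (n<1+n q) sq<L

  finish : ∀ {j q τ} → ClearFrom q τ → j ≤ d → suc q ≡ L →
           Run ⟨ (advance , j) , q , setBit τ q ⟩ ⟨ afterLevel j , q , τ ⟩
  finish {j} {q} {τ} clear j≤d sq≡L =
    advance-step (update-at τ q true) j≤d q<L (moveAddr-right-blocked sq≡L) ⨾
    advanced-blocked-step (clear q ≤-refl q<L) j≤d q<L
    where
    q<L : q < L
    q<L = subst (q <_) sq≡L (n<1+n q)

  -- Steps spent by level i + 1 for each cell its mark visits: a round of level i + 2 runs
  -- level i + 1 over the at most L cells to its right and scans back over them.
  levelCost : ℕ → ℕ
  levelCost zero    = 7
  levelCost (suc i) = 8 + L + L * levelCost i

  -- Level i + 1 started at cell q, where q + n is the last cell.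
  Completes : ℕ → ℕ → ℕ → Tape → Set
  Completes i n q τ =
    RunWithin ⟨ (mark , suc i) , q , τ ⟩ ⟨ afterLevel (suc i) , q + n , τ ⟩ (suc n * levelCost i)

  LevelOutcome : ℕ → ℕ → ℕ → Tape → Set
  LevelOutcome i n q τ =
    (AllGood (suc i) q τ × Completes i n q τ) ⊎
    (¬ AllGood (suc i) q τ × Rejecting ⟨ (mark , suc i) , q , τ ⟩)

  round₁ : ∀ {q τ} → Good (setBit τ q) → 1 ≤ d → suc q < L → ClearFrom q τ →
           RunWithin ⟨ (mark , 1) , q , τ ⟩ ⟨ (mark , 1) , suc q , τ ⟩ (levelCost 0)
  round₁ {q} good 1≤d sq<L clear =
    mark-query₁ good 1≤d (<-trans (n<1+n q) sq<L) ⨾ shift clear 1≤d sq<L , m≤m+n 5 2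

  round₊ : ∀ {i n q τ} → Good (setBit τ q) → suc (suc i) ≤ d → suc q + suc n ≡ L → ClearFrom q τ →
           Completes i n (suc q) (setBit τ q) →
           RunWithin ⟨ (mark , suc (suc i)) , q , τ ⟩ ⟨ (mark , suc (suc i)) , suc q , τ ⟩ (levelCost (suc i))
  round₊ {i} {n} {q} {τ} good j≤d eq clear (inner , inner≤) =
    descend good j≤d sq<L clear ⨾ Run-retarget returned inner ⨾ scan-back ⨾ shift clear j≤d sq<L , cost≤
    where
    sq<L : suc q < L
    sq<L = cell<L eq
    sn+q<L : suc n + q < L
    sn+q<L = subst (_< L) (trans (+-suc q n) (cong suc (+-comm q n))) (subst (q + suc n <_) eq (n<1+n _))
    returned : ⟨ afterLevel (suc i) , suc q + n , setBit τ q ⟩ ≡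
               ⟨ (scan , suc (suc i)) , suc n + q , setBit τ q ⟩
    returned = cong₂ (λ s h → ⟨ s , h , setBit τ q ⟩) (afterLevel-below j≤d) (cong suc (+-comm q n))
    clear-between : ∀ t → t < suc n → setBit τ q (suc t + q) ≡ false
    clear-between t t<sn =
      trans (update-other τ true (>⇒≢ (s≤s (m≤n+m q t))))
            (clear (suc t + q) (≤-trans (n≤1+n q) (s≤s (m≤n+m q t))) (≤-<-trans (+-monoˡ-≤ q t<sn) sn+q<L))
    scan-back : Run ⟨ (scan , suc (suc i)) , suc n + q , setBit τ q ⟩ ⟨ (advance , suc (suc i)) , q , setBit τ q ⟩
    scan-back = scan-run (suc n) j≤d sn+q<L (update-at τ q true) clear-between
    cost≤ : 3 + (cost inner + (cost scan-back + 3)) ≤ levelCost (suc i)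
    cost≤ = begin
      3 + (cost inner + (cost scan-back + 3))
        ≡⟨ cong (λ s → 3 + (cost inner + (s + 3))) (cost-scan-run (suc n) j≤d sn+q<L _ clear-between) ⟩
      3 + (cost inner + (suc (suc n) + 3))
        ≡⟨ solve 2 (λ a n → con 3 :+ (a :+ (n :+ con 3)) := (con 6 :+ n) :+ a) refl (cost inner) (suc (suc n)) ⟩
      6 + suc (suc n) + cost inner
        ≤⟨ +-mono-≤ (+-monoʳ-≤ 6 ssn≤L) (≤-trans inner≤ (*-monoˡ-≤ (levelCost i) (<⇒≤ ssn≤L))) ⟩
      6 + L + L * levelCost i
        ≤⟨ +-monoˡ-≤ (L * levelCost i) (+-monoˡ-≤ L (m≤m+n 6 2)) ⟩
      8 + L + L * levelCost i
        ∎
      where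
      open ≤-Reasoning
      ssn≤L : suc (suc n) ≤ L
      ssn≤L = subst (suc (suc n) ≤_) eq (s≤s (m≤n+m (suc n) q))

  final₁ : ∀ {q τ} → Good (setBit τ q) → 1 ≤ d → suc q ≡ L → ClearFrom q τ →
           RunWithin ⟨ (mark , 1) , q , τ ⟩ ⟨ afterLevel 1 , q , τ ⟩ (levelCost 0)
  final₁ {q} good 1≤d sq≡L clear =
    mark-query₁ good 1≤d (subst (q <_) sq≡L (n<1+n q)) ⨾ finish clear 1≤d sq≡L , m≤m+n 4 3

  final₊ : ∀ {i q τ} → Good (setBit τ q) → suc (suc i) ≤ d → suc q ≡ L → ClearFrom q τ →
           RunWithin ⟨ (mark , suc (suc i)) , q , τ ⟩ ⟨ afterLevel (suc (suc i)) , q , τ ⟩ (levelCost (suc i))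
  final₊ good j≤d sq≡L clear = mark-query₊-blocked good j≤d sq≡L ⨾ finish clear j≤d sq≡L , m≤m+n 5 _

  level-rejects : ∀ {i q τ} → ¬ Good (setBit τ q) → suc i ≤ d → q < L →
                  ¬ AllGood (suc i) q τ × Rejecting ⟨ (mark , suc i) , q , τ ⟩
  level-rejects {i} bad j≤d q<L =
    (λ all → bad (proj₁ (all _ ≤-refl q<L))) ,
    Rejecting-backward (mark-step j≤d q<L) (query-rejects {suc i} bad q<L)

  level-stop : ∀ {i q τ} → Good (setBit τ q) → suc q ≡ L →
               RunWithin ⟨ (mark , suc i) , q , τ ⟩ ⟨ afterLevel (suc i) , q , τ ⟩ (levelCost i) →
               AllGood (suc i) q τ × Completes i 0 q τ
  level-stop {i} {q} good sq≡L (r , r≤) =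
    AllGood-cons good (AllGood-beyond i L≤sq) (AllGood-beyond (suc i) L≤sq) ,
    RunWithin-head (sym (+-identityʳ q)) (r , ≤-trans r≤ (≤-reflexive (sym (*-identityˡ (levelCost i)))))
    where
    L≤sq : L ≤ suc q
    L≤sq = ≤-reflexive (sym sq≡L)

  level-continue : ∀ {i n q τ} → Good (setBit τ q) → AllGood i (suc q) (setBit τ q) →
                   RunWithin ⟨ (mark , suc i) , q , τ ⟩ ⟨ (mark , suc i) , suc q , τ ⟩ (levelCost i) →
                   LevelOutcome i n (suc q) τ → LevelOutcome i (suc n) q τ
  level-continue {q = q} _ _ round (inj₂ (¬all , rej)) =
    inj₂ (¬all ∘ AllGood-mono (n≤1+n q) , Rejecting-backward (proj₁ round) rej)
  level-continue {n = n} {q} good inner round (inj₁ (all , rest)) =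
    inj₁ (AllGood-cons good inner all , RunWithin-head (sym (+-suc q n)) (round ⨾≤ rest))

  level-descend : ∀ {i n q τ} → Good (setBit τ q) → suc (suc i) ≤ d → suc q + suc n ≡ L →
                  ClearFrom q τ →
                  LevelOutcome i n (suc q) (setBit τ q) → LevelOutcome (suc i) n (suc q) τ →
                  LevelOutcome (suc i) (suc n) q τ
  level-descend {q = q} good j≤d eq clear (inj₂ (¬inner , rej)) _ =
    inj₂ ((λ all → ¬inner (proj₂ (all q ≤-refl (<-trans (n<1+n q) (cell<L eq))))) ,
          Rejecting-backward (descend good j≤d (cell<L eq) clear) rej)
  level-descend good j≤d eq clear (inj₁ (inner , completes)) rest =
    level-continue good inner (round₊ good j≤d eq clear completes) rest

  level : ∀ i n q τ → q + suc n ≡ L → suc i ≤ d → ClearFrom q τ → LevelOutcome i n q τ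
  level i n q τ eq j≤d clear with good? (setBit τ q)
  ... | no bad = inj₂ (level-rejects bad j≤d (cell<L eq))
  level zero zero q τ eq j≤d clear | yes good =
    inj₁ (level-stop good (last-cell eq) (final₁ good j≤d (last-cell eq) clear))
  level (suc i) zero q τ eq j≤d clear | yes good =
    inj₁ (level-stop good (last-cell eq) (final₊ good j≤d (last-cell eq) clear))
  level zero (suc n) q τ eq j≤d clear | yes good =
    level-continue good tt (round₁ good j≤d (cell<L (next-cell eq)) clear)
      (level zero n (suc q) τ (next-cell eq) j≤d (ClearFrom-suc clear))
  level (suc i) (suc n) q τ eq j≤d clear | yes good =
    level-descend good j≤d (next-cell eq) clear
      (level i n (suc q) (setBit τ q) (next-cell eq) (≤-trans (n≤1+n _) j≤d) (ClearFrom-setBit clear))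
      (level (suc i) n (suc q) τ (next-cell eq) j≤d (ClearFrom-suc clear))

  levelCost≤ : 1 ≤ L → ∀ i → levelCost i ≤ 9 * suc i * L ^ i
  levelCost≤ 1≤L zero    = m≤m+n 7 2
  levelCost≤ 1≤L (suc i) = begin
    8 + L + L * levelCost i
      ≤⟨ +-mono-≤ (+-monoˡ-≤ L (*-monoʳ-≤ 8 1≤L)) (*-monoʳ-≤ L (levelCost≤ 1≤L i)) ⟩
    8 * L + L + L * (9 * suc i * X)
      ≤⟨ +-monoˡ-≤ (L * (9 * suc i * X)) (≤-trans (≤-reflexive 8L+L≡9L) (*-monoʳ-≤ 9 L≤LX)) ⟩
    9 * (L * X) + L * (9 * suc i * X)
      ≡⟨ solve 3 (λ L X i → con 9 :* (L :* X) :+ L :* (con 9 :* (con 1 :+ i) :* X)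
                            := con 9 :* (con 2 :+ i) :* (L :* X)) refl L X i ⟩
    9 * suc (suc i) * (L * X)
      ∎
    where
    open ≤-Reasoning
    X = L ^ i
    8L+L≡9L : 8 * L + L ≡ 9 * L
    8L+L≡9L = solve 1 (λ L → con 8 :* L :+ L := con 9 :* L) refl L
    L≤LX : L ≤ L * X
    L≤LX = subst (_≤ L * X) (*-identityʳ L) (*-monoʳ-≤ L (subst (_≤ X) (^-zeroˡ i) (^-monoˡ-≤ i 1≤L)))

  AllGood-everywhere : (∀ τ → Good τ) → ∀ i q τ → AllGood i q τ
  AllGood-everywhere good zero    q τ = tt
  AllGood-everywhere good (suc i) q τ q' _ _ = good _ , AllGood-everywhere good i (suc q') _

  place-Good : ∀ B j q τ (f : Fin (suc j) → Fin B) → AllGood (suc j) q τ → q + suc j * B ≤ L →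
               Good (place B (suc j) q τ f)
  place-Good B j q τ f all bound with all (q + a) (m≤m+n q a) q+a<L
    where
    a = toℕ (f Fin.zero)
    q+a<L : q + a < L
    q+a<L = <-≤-trans (+-monoʳ-< q (toℕ<n (f Fin.zero))) (≤-trans (+-monoʳ-≤ q (m≤m+n B (j * B))) bound)
  place-Good B zero    q τ f all bound | good , _    = good
  place-Good B (suc j) q τ f all bound | _    , rest =
    place-Good B j (q + B) _ (f ∘ Fin.suc)
      (AllGood-mono (subst (_≤ q + B) (+-suc q _) (+-monoʳ-≤ q (toℕ<n (f Fin.zero)))) rest)
      (≤-trans (≤-reflexive (+-assoc q B (suc j * B))) bound)

-- The separation

blank : Tape
blank _ = false

module _ (k : ℕ) (x : List Bool) where
  open Enumerator (suc k)
  open Simulation (suc k) x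

  initial-Matches : Matches ⟨ (mark , suc k) , 0 , blank ⟩ (initial machine)
  initial-Matches = toℕ-toState (encode<Q mark ≤-refl) , refl , λ _ _ → refl

  EnumLang⇔AllGood : 1 ≤ L →
    (AllGood (suc k) 0 blank → AcceptsWithin machine x (L * levelCost k)) ×
    (EnumLang (suc k) x → AllGood (suc k) 0 blank)
  EnumLang⇔AllGood 1≤L with level k (L ∸ 1) 0 blank (m+[n∸m]≡n 1≤L) ≤-refl (λ _ _ _ → refl)
  ... | inj₁ (all , r , r≤) =
    (λ _ → AccWithin-mono machine cost≤ (forward r 0 accepts-after-top (initial machine) initial-Matches)) ,
    (λ _ → all)
    where
    accepts-after-top : ∀ {h τ} → Accepting 0 ⟨ afterLevel (suc k) , h , τ ⟩
    accepts-after-top {h} {τ} c c≈ =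
      here (trans (accepting-Matches {afterLevel (suc k)} {h} {τ} c c≈) (cong (isAccept ∘ proj₁) afterLevel-top))
    cost≤ : cost r + 0 ≤ L * levelCost k
    cost≤ = ≤-trans (≤-reflexive (+-identityʳ (cost r))) (subst (λ n → cost r ≤ n * levelCost k) (m+[n∸m]≡n 1≤L) r≤)
  ... | inj₂ (¬all , rej) =
    (λ all → contradiction all ¬all) , λ (m , acc) → ⊥-elim (rej m (initial machine) initial-Matches acc)

log₂≥1 : ∀ n → 2 ≤ n → 1 ≤ ⌈log₂ n ⌉
log₂≥1 n 2≤n = subst (_≤ ⌈log₂ n ⌉) (⌈log₂2^n⌉≡n 1) (⌈log₂⌉-mono-≤ 2≤n)

logPow≤logPow-suc : ∀ k n → 2 ≤ n → logPow k n ≤ logPow (suc k) n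
logPow≤logPow-suc k n 2≤n =
  subst (_≤ ⌈log₂ n ⌉ * ⌈log₂ n ⌉ ^ k) (*-identityˡ _) (*-monoˡ-≤ (⌈log₂ n ⌉ ^ k) (log₂≥1 n 2≤n))

EnumLang∈NTIME : ∀ k → NTIME (logPow (suc k)) (EnumLang (suc k))
EnumLang∈NTIME k = machine , 9 * suc k , 2 , (λ x → (λ acc → acc) , (λ acc → acc)) , fast
  where
  open Enumerator (suc k)
  fast : ∀ x → 2 ≤ length x → Accepts machine x →
         AcceptsWithin machine x (9 * suc k * logPow (suc k) (length x))
  fast x 2≤|x| acc =
    AccWithin-mono machine bound (proj₁ (EnumLang⇔AllGood k x 1≤L) (proj₂ (EnumLang⇔AllGood k x 1≤L) acc))
    where
    open Simulation (suc k) x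
    1≤L : 1 ≤ L
    1≤L = log₂≥1 (length x) 2≤|x|
    bound : L * levelCost k ≤ 9 * suc k * (L * L ^ k)
    bound = begin
      L * levelCost k          ≤⟨ *-monoʳ-≤ L (levelCost≤ 1≤L k) ⟩
      L * (9 * suc k * L ^ k)  ≡⟨ solve 3 (λ L X k → L :* (con 9 :* (con 1 :+ k) :* X)
                                                   := con 9 :* (con 1 :+ k) :* (L :* X)) refl L (L ^ k) k ⟩
      9 * suc k * (L * L ^ k)  ∎
      where open ≤-Reasoning

module Adversary (k : ℕ) (M : NRTM) (c n₀ : ℕ)
  (decides : ∀ x → (EnumLang (suc k) x → Accepts M x) × (Accepts M x → EnumLang (suc k) x))
  (fast : ∀ x → n₀ ≤ length x → Accepts M x → AcceptsWithin M x (c * logPow k (length x))) where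

  D B width n : ℕ
  D = suc k
  B = suc (c * D ^ k + n₀)
  width = D * B
  n = 2 ^ width

  ⌈log₂⌉≡width : ∀ (y : List Bool) → length y ≡ n → ⌈log₂ length y ⌉ ≡ width
  ⌈log₂⌉≡width y |y|≡n = trans (cong ⌈log₂_⌉ |y|≡n) (⌈log₂2^n⌉≡n width)

  1≤⌈log₂⌉ : ∀ (y : List Bool) → length y ≡ n → 1 ≤ ⌈log₂ length y ⌉
  1≤⌈log₂⌉ y |y|≡n = subst (1 ≤_) (sym (⌈log₂⌉≡width y |y|≡n)) (s≤s z≤n)

  placement : Fin (B ^ D) → Tape
  placement i = place B D 0 blank (finToFun i)

  address : Fin (B ^ D) → ℕ
  address i = addrValue width (placement i)

  address-injective : ∀ i j → address i ≡ address j → i ≡ j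
  address-injective i j same = finToFun-injective i j
    (place-injective B D 0 blank (λ _ _ → refl) _ _ (addrValue-injective width (placement i) (placement j) same))

  ones : List Bool
  ones = replicate n true

  ones-accepted : AcceptsWithin M ones (c * logPow k (length ones))
  ones-accepted = fast ones n₀≤|ones|
    (proj₁ (decides ones) (_ , proj₁ (EnumLang⇔AllGood k ones (1≤⌈log₂⌉ ones (length-replicate n))) all-good))
    where
    n₀≤|ones| : n₀ ≤ length ones
    n₀≤|ones| = subst (n₀ ≤_) (sym (length-replicate n))
      (≤-trans (m≤n+m n₀ (c * D ^ k)) (≤-trans (m≤m+n _ (k * B)) (≤-trans (n≤1+n _) (<⇒≤ (n<2^n width)))))
    all-good : Simulation.AllGood (suc k) ones (suc k) 0 blank
    all-good = Simulation.AllGood-everywhere (suc k) ones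
                 (λ τ → readIn-ones n (addrValue (addrLen (length ones)) τ)) (suc k) 0 blank

  queries : List ℕ
  queries = proj₁ (AccWithin-queries M ones ones-accepted)

  transfer : ∀ x' → length ones ≡ length x' → (∀ a → a ∈ queries → readIn ones a ≡ readIn x' a) →
             AcceptsWithin M x' (c * logPow k (length ones))
  transfer = proj₂ (proj₂ (AccWithin-queries M ones ones-accepted))

  few-queries : length queries < B ^ D
  few-queries = begin-strict
    length queries                ≤⟨ proj₁ (proj₂ (AccWithin-queries M ones ones-accepted)) ⟩
    c * ⌈log₂ length ones ⌉ ^ k   ≡⟨ cong (λ l → c * l ^ k) (⌈log₂⌉≡width ones (length-replicate n)) ⟩
    c * (D * B) ^ k               ≡⟨ cong (c *_) (*-^-distrib D B k) ⟩
    c * (D ^ k * B ^ k)           ≡⟨ *-assoc c (D ^ k) (B ^ k) ⟨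
    c * D ^ k * B ^ k             <⟨ +-monoˡ-≤ (c * D ^ k * B ^ k) (m^n>0 B k) ⟩
    B ^ k + c * D ^ k * B ^ k     ≤⟨ *-monoˡ-≤ (B ^ k) (s≤s (m≤m+n (c * D ^ k) n₀)) ⟩
    B * B ^ k                     ∎
    where open ≤-Reasoning

  unread-exists : ∃ λ i → ¬ address i ∈ queries
  unread-exists = injective-avoids-short-list (B ^ D) address address-injective queries few-queries

  unread : Fin (B ^ D)
  unread = proj₁ unread-exists

  flipped : List Bool
  flipped = onesExcept n (address unread)

  |flipped| : length flipped ≡ n
  |flipped| = length-onesExcept n (address unread)

  flipped-accepted : EnumLang (suc k) flipped
  flipped-accepted =
    proj₂ (decides flipped) (_ , transfer flipped (trans (length-replicate n) (sym |flipped|)) agree)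
    where
    agree : ∀ a → a ∈ queries → readIn ones a ≡ readIn flipped a
    agree a a∈queries =
      readIn-onesExcept-other n (address unread) a λ a≡ → proj₂ unread-exists (subst (_∈ queries) a≡ a∈queries)

  impossible : ⊥
  impossible = good (subst (λ l → readIn flipped (addrValue l (placement unread)) ≡ bit false)
                           (sym (⌈log₂⌉≡width flipped |flipped|))
                           (readIn-onesExcept-at n (address unread) (addrValue<2^ width (placement unread))))
    where
    all-good : Simulation.AllGood (suc k) flipped (suc k) 0 blank
    all-good = proj₂ (EnumLang⇔AllGood k flipped (1≤⌈log₂⌉ flipped |flipped|)) flipped-accepted
    good : Simulation.Good (suc k) flipped (placement unread)
    good = Simulation.place-Good (suc k) flipped B k 0 blank (finToFun unread) all-good
             (≤-reflexive (sym (⌈log₂⌉≡width flipped |flipped|)))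

EnumLang∉NTIME : ∀ k → ¬ NTIME (logPow k) (EnumLang (suc k))
EnumLang∉NTIME k (M , c , n₀ , decides , fast) = Adversary.impossible k M c n₀ decides fast

theorem2 : (k : ℕ) → 1 < k →
    ((L : Pred (List Bool) 0ℓ) → NTIME (logPow k) L → NTIME (logPow (suc k)) L) ×
    Σ (Pred (List Bool) 0ℓ) (λ L → NTIME (logPow (suc k)) L × ¬ NTIME (logPow k) L)
theorem2 k _ =
  (λ _ → NTIME-mono 2 (logPow≤logPow-suc k)) ,
  EnumLang (suc k) , EnumLang∈NTIME k , EnumLang∉NTIME k
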